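{- (i) For $n\ge3$, the polynomial $R_n^{(1,0,1,0)}(x)$ has degree $n-2$ and leading coefficient $(n-2)!$. (ii) For $n\ge4$, $R_n^{(1,0,2,0)}(x)$ has degree $n-3$ and leading coefficient $2(n-3)!$. (iii) For $n\ge5$, $R_n^{(2,0,2,0)}(x)$ has degree $n-4$ and leading coefficient $4(n-4)!$.
   Context: For $\sigma=\sigma_1\cdots\sigma_n\in S_n$ and $a,c\in\mathbb{N}$, $\sigma_i$ matches $MMP(a,0,c,0)$ if there are at least $a$ indices $j>i$ with $\sigma_j>\sigma_i$ and at least $c$ indices $j<i$ with $\sigma_j<\sigma_i$. $mmp^{(a,0,c,0)}(\sigma)$ is the number of such $i$, and $R_n^{(a,0,c,0)}(x)=\sum_{\sigma\in S_n}x^{mmp^{(a,0,c,0)}(\sigma)}$. -}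

module Defs where

open import Data.Nat using (ℕ; zero; suc; _+_; _≤?_; _<?_; _≟_)
open import Data.List using (List; []; _∷_; _++_; [_]; length; filter; map; concatMap; upTo)
open import Relation.Nullary using (does)
open import Data.Bool using (Bool; if_then_else_; _∧_)
import Data.List.Relation.Unary.Unique.DecPropositional as UniqueDec

-- A permutation σ = σ₁ ⋯ σₙ ∈ Sₙ is represented in one-line notation as a
-- list of length n with entries in {0,…,n-1}, all distinct.

words : ℕ → ℕ → List (List ℕ)
words n zero    = [] ∷ []
words n (suc k) = concatMap (λ x → map (x ∷_) (words n k)) (upTo n)

Sym : ℕ → List (List ℕ)
Sym n = filter (UniqueDec.unique? _≟_) (words n n)

#greater : ℕ → List ℕ → ℕ
#greater x [] = 0
#greater x (y ∷ ys) = (if does (x <? y) then 1 else 0) + #greater x ys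

#less : ℕ → List ℕ → ℕ
#less x [] = 0
#less x (y ∷ ys) = (if does (y <? x) then 1 else 0) + #less x ys

mmpAux : ℕ → ℕ → List ℕ → List ℕ → ℕ
mmpAux a c pre [] = 0
mmpAux a c pre (x ∷ xs) =
  (if does (a ≤? #greater x xs) ∧ does (c ≤? #less x pre) then 1 else 0)
  + mmpAux a c (pre ++ [ x ]) xs

mmp : ℕ → ℕ → List ℕ → ℕ
mmp a c σ = mmpAux a c [] σ

-- coefficient of x^k in R_n^{(a,0,c,0)}(x) = #{σ ∈ Sₙ : mmp^{(a,0,c,0)}(σ) = k}
coeffR : ℕ → ℕ → ℕ → ℕ → ℕ
coeffR a c n k = length (filter (λ σ → mmp a c σ ≟ k) (Sym n))

-- Write n = c + m + a with m ≥ 1. An entry among the first c positions has fewer than c entries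
-- to its left and one among the last a positions fewer than a entries to its right, so
-- mmp^{(a,0,c,0)} ≤ m. If all m middle entries match, each has c smaller entries before it and
-- a larger ones after it, so by pigeonhole the middle block is {c, …, c+m-1}; counting the entries
-- ≥ c and < c+m then forces the first block to be {0, …, c-1} and the last {c+m, …, n-1}.
-- Conversely every such permutation attains m, so the top coefficient is c! m! a!.

module Submission where

open import Defs
open import Data.Nat using (ℕ; zero; suc; _+_; _*_; _∸_; _≤_; _<_; z≤n; s≤s; z<s; _≤?_; _<?_; _≟_; _<ᵇ_; _!)
open import Data.Nat.Properties
open import Data.Bool using (true; false; if_then_else_; _∧_)
open import Data.List using (List; []; _∷_; initLast; _∷ʳ′_; _++_; [_]; length; filter; map; concatMap; upTo)
open import Data.Nat.ListAction using (sum; product)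
open import Data.List.Properties
  using (length-++; ++-assoc; ++-identityʳ; applyUpTo-∷ʳ; length-filter;
         filter-++; filter-all; filter-none; filter-accept; filter-reject; filter-some; filter-complete)
open import Data.List.Relation.Unary.All as All using (All; []; _∷_)
import Data.List.Relation.Unary.All.Properties as All
open import Data.List.Relation.Unary.Any using (here; there)
open import Data.List.Relation.Unary.AllPairs using ([]; _∷_)
open import Data.List.Relation.Unary.Unique.Propositional using (Unique)
open import Data.List.Relation.Unary.Unique.DecPropositional _≟_ using (unique?)
open import Data.List.Relation.Unary.Unique.Propositional.Properties using (upTo⁺; filter⁺; ++⁺)
open import Data.List.Membership.Propositional using (_∈_; _∉_)
open import Data.List.Membership.Propositional.Properties using (∈-upTo⁺; ∈-upTo⁻; ∈-++⁺ʳ; ∈-++⁺ˡ; ∈-++⁻)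
open import Data.List.Relation.Binary.Disjoint.Propositional using (Disjoint)
open import Data.List.Membership.DecPropositional _≟_ using (_∈?_)
open import Data.Product using (_×_; _,_; proj₁; proj₂; ∃₂; Σ-syntax; map₁)
open import Data.Sum using (inj₁; inj₂) renaming ([_,_] to [_,_]′)
open import Data.Unit using (⊤; tt)
open import Data.Empty using (⊥)
open import Function using (_∘_; id)
open import Relation.Nullary using (Dec; yes; no; ¬_; does; contradiction)
open import Relation.Nullary.Decidable using (_×-dec_; ¬?)
open import Relation.Unary using (Decidable)
open import Relation.Binary.PropositionalEquality hiding ([_])

count : {A : Set} {P : A → Set} → Decidable P → List A → ℕ
count P? xs = length (filter P? xs)

module _ {A : Set} where

  count-cong-All : {P Q : A → Set} (P? : Decidable P) (Q? : Decidable Q) (xs : List A) →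
    All (λ x → (P x → Q x) × (Q x → P x)) xs → count P? xs ≡ count Q? xs
  count-cong-All P? Q? [] [] = refl
  count-cong-All P? Q? (x ∷ xs) ((P⇒Q , Q⇒P) ∷ h) with P? x | Q? x
  ... | yes _ | yes _ = cong suc (count-cong-All P? Q? xs h)
  ... | yes p | no ¬q = contradiction (P⇒Q p) ¬q
  ... | no ¬p | yes q = contradiction (Q⇒P q) ¬p
  ... | no _  | no _  = count-cong-All P? Q? xs h

  count-++ : {P : A → Set} (P? : Decidable P) (xs ys : List A) →
    count P? (xs ++ ys) ≡ count P? xs + count P? ys
  count-++ P? xs ys = trans (cong length (filter-++ P? xs ys)) (length-++ (filter P? xs))

  count-all : {P : A → Set} (P? : Decidable P) {xs : List A} → All P xs → count P? xs ≡ length xs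
  count-all P? all = cong length (filter-all P? all)

  count-filter : {P Q : A → Set} (P? : Decidable P) (Q? : Decidable Q) (xs : List A) →
    count P? (filter Q? xs) ≡ count (λ x → Q? x ×-dec P? x) xs
  count-filter P? Q? [] = refl
  count-filter P? Q? (x ∷ xs) with Q? x
  ... | no _ = count-filter P? Q? xs
  ... | yes _ with P? x
  ...   | yes _ = cong suc (count-filter P? Q? xs)
  ...   | no _  = count-filter P? Q? xs

  count-remove : {P : A → Set} (P? : Decidable P) (_≟ₐ_ : (x y : A) → Dec (x ≡ y)) {x : A} (xs : List A) →
    Unique xs → x ∈ xs → P x → count P? xs ≡ suc (count (λ y → P? y ×-dec ¬? (y ≟ₐ x)) xs)
  count-remove P? _≟ₐ_ {x} (x ∷ xs) (x∉xs ∷ _) (here refl) px = begin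
    count P? (x ∷ xs)          ≡⟨ cong length (filter-accept P? px) ⟩
    suc (count P? xs)          ≡⟨ cong suc (count-cong-All P? P?≢x xs
                                    (All.map (λ x≢y → (λ py → py , x≢y ∘ sym) , proj₁) x∉xs)) ⟩
    suc (count P?≢x xs)        ≡⟨ cong (suc ∘ length) (filter-reject P?≢x (λ (_ , x≢x) → x≢x refl)) ⟨
    suc (count P?≢x (x ∷ xs))  ∎
    where
    open ≡-Reasoning
    P?≢x = λ y → P? y ×-dec ¬? (y ≟ₐ x)
  count-remove {P} P? _≟ₐ_ {x} (y ∷ xs) (y∉xs ∷ u) (there x∈xs) px = step (P? y)
    where
    P?≢x = λ z → P? z ×-dec ¬? (z ≟ₐ x)
    ih = count-remove P? _≟ₐ_ xs u x∈xs px
    step : Dec (P y) → count P? (y ∷ xs) ≡ suc (count P?≢x (y ∷ xs))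
    step (yes py) = trans (cong length (filter-accept P? py))
      (cong suc (trans ih (cong length (sym (filter-accept P?≢x (py , All.lookup y∉xs x∈xs))))))
    step (no ¬py) = trans (cong length (filter-reject P? ¬py))
      (trans ih (cong (suc ∘ length) (sym (filter-reject P?≢x (¬py ∘ proj₁)))))

  count-map : {B : Set} {P : B → Set} (P? : Decidable P) (f : A → B) (xs : List A) →
    count P? (map f xs) ≡ count (P? ∘ f) xs
  count-map P? f [] = refl
  count-map P? f (x ∷ xs) with P? (f x)
  ... | yes _ = cong suc (count-map P? f xs)
  ... | no _  = count-map P? f xs

  sum-map-supported : {Q : A → Set} (Q? : Decidable Q) (g : A → ℕ) (C : ℕ) (xs : List A) →
    (∀ x → Q x → g x ≡ C) → (∀ x → ¬ Q x → g x ≡ 0) → sum (map g xs) ≡ count Q? xs * C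
  sum-map-supported Q? g C [] _ _ = refl
  sum-map-supported Q? g C (x ∷ xs) onQ offQ with Q? x
  ... | yes q  = cong₂ _+_ (onQ x q) (sum-map-supported Q? g C xs onQ offQ)
  ... | no ¬q = cong₂ _+_ (offQ x ¬q) (sum-map-supported Q? g C xs onQ offQ)

module _ {A : Set} {P : A → Set} (P? : Decidable P) where

  count≥length⇒All : ∀ xs → length xs ≤ count P? xs → All P xs
  count≥length⇒All xs len≤ = subst (All P) (filter-complete P? (≤-antisym (length-filter P? xs) len≤)) (All.all-filter P? xs)

  count≤0⇒All¬ : ∀ xs → count P? xs ≤ 0 → All (¬_ ∘ P) xs
  count≤0⇒All¬ xs count≤0 = All.¬Any⇒All¬ xs λ any → <⇒≱ (filter-some P? any) count≤0

Unique-++⁻ : ∀ {A : Set} (xs : List A) {ys} → Unique (xs ++ ys) → Unique xs × Unique ys × Disjoint xs ys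
Unique-++⁻ [] u = [] , u , λ ()
Unique-++⁻ (x ∷ xs) (x∉ ∷ u) with Unique-++⁻ xs u
... | uxs , uys , xs#ys = All.++⁻ˡ xs x∉ ∷ uxs , uys , λ where
  (here refl , v∈ys) → All.lookup (All.++⁻ʳ xs x∉) v∈ys refl
  (there v∈xs , v∈ys) → xs#ys (v∈xs , v∈ys)

Unique-∷ʳ : ∀ {A : Set} {xs : List A} {x} → Unique xs → x ∉ xs → Unique (xs ++ [ x ])
Unique-∷ʳ u x∉xs = ++⁺ u ([] ∷ []) λ where (x∈xs , here refl) → x∉xs x∈xs

splitAt-length : ∀ {A : Set} i j (xs : List A) → length xs ≡ i + j →
  ∃₂ λ p q → xs ≡ p ++ q × length p ≡ i × length q ≡ j
splitAt-length zero j xs len≡ = [] , xs , refl , refl , len≡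
splitAt-length (suc i) j (x ∷ xs) len≡ with splitAt-length i j xs (suc-injective len≡)
... | p , q , refl , refl , len-q = x ∷ p , q , refl , refl , len-q

indicator : {P Q : Set} → Dec P → Dec Q → ℕ
indicator p q = if does p ∧ does q then 1 else 0

module _ {P Q : Set} where

  indicator≤1 : (p : Dec P) (q : Dec Q) → indicator p q ≤ 1
  indicator≤1 (yes _) (yes _) = ≤-refl
  indicator≤1 (yes _) (no _)  = z≤n
  indicator≤1 (no _)  _       = z≤n

  indicator≡0ˡ : (p : Dec P) (q : Dec Q) → ¬ P → indicator p q ≡ 0
  indicator≡0ˡ (yes x) _ ¬x = contradiction x ¬x
  indicator≡0ˡ (no _)  _ _  = refl

  indicator≡0ʳ : (p : Dec P) (q : Dec Q) → ¬ Q → indicator p q ≡ 0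
  indicator≡0ʳ _       (yes y) ¬y = contradiction y ¬y
  indicator≡0ʳ (yes _) (no _)  _  = refl
  indicator≡0ʳ (no _)  (no _)  _  = refl

  indicator≡1 : (p : Dec P) (q : Dec Q) → P → Q → indicator p q ≡ 1
  indicator≡1 (yes _) (yes _) _ _  = refl
  indicator≡1 (no ¬x) _       x _  = contradiction x ¬x
  indicator≡1 (yes _) (no ¬y) _ y  = contradiction y ¬y

  indicator≡1⁻ : (p : Dec P) (q : Dec Q) → indicator p q ≡ 1 → P × Q
  indicator≡1⁻ (yes x) (yes y) _ = x , y
  indicator≡1⁻ (yes _) (no _)  ()
  indicator≡1⁻ (no _)  _       ()

InRange : ℕ → ℕ → ℕ → Set
InRange lo hi x = lo ≤ x × x < hi

InRange? : ∀ lo hi → Decidable (InRange lo hi)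
InRange? lo hi x = (lo ≤? x) ×-dec (x <? hi)

length≤1+count-≢ : ∀ h (xs : List ℕ) → Unique xs → length xs ≤ suc (count (λ y → ¬? (y ≟ h)) xs)
length≤1+count-≢ h [] _ = z≤n
length≤1+count-≢ h (x ∷ xs) (x∉xs ∷ u) with x ≟ h
... | yes refl = s≤s (≤-reflexive (sym (trans (cong length (filter-reject ≢x? (λ x≢x → x≢x refl)))
                                                (count-all ≢x? (All.map (_∘ sym) x∉xs)))))
  where ≢x? = λ y → ¬? (y ≟ x)
... | no x≢h   = subst (suc (length xs) ≤_) (cong (suc ∘ length) (sym (filter-accept (λ y → ¬? (y ≟ h)) x≢h)))
                   (s≤s (length≤1+count-≢ h xs u))

length-unique-inRange : ∀ lo hi (xs : List ℕ) → Unique xs → All (InRange lo hi) xs → length xs ≤ hi ∸ lo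
length-unique-inRange lo hi [] _ _ = z≤n
length-unique-inRange lo zero (x ∷ xs) _ ((_ , ()) ∷ _)
length-unique-inRange lo (suc h) xs@(x ∷ _) u xs∈@((lo≤x , x≤h) ∷ _) = begin
  length xs            ≤⟨ length≤1+count-≢ h xs u ⟩
  suc (length xs≢h)    ≤⟨ s≤s (length-unique-inRange lo h xs≢h (filter⁺ ≢h? u) xs≢h∈) ⟩
  suc (h ∸ lo)         ≡⟨ +-∸-assoc 1 (≤-trans lo≤x (≤-pred x≤h)) ⟨
  suc h ∸ lo           ∎
  where
  open ≤-Reasoning
  ≢h? = λ y → ¬? (y ≟ h)
  xs≢h = filter ≢h? xs
  xs≢h∈ : All (InRange lo h) xs≢h
  xs≢h∈ = All.map (λ (y≢h , lo≤y , y≤h) → lo≤y , ≤∧≢⇒< (≤-pred y≤h) y≢h)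
            (All.zip (All.all-filter ≢h? xs , All.filter⁺ ≢h? xs∈))

count-<-unique : ∀ hi (xs : List ℕ) → Unique xs → count (_<? hi) xs ≤ hi
count-<-unique hi xs u = length-unique-inRange 0 hi (filter (_<? hi) xs) (filter⁺ (_<? hi) u)
  (All.map (z≤n ,_) (All.all-filter (_<? hi) xs))

count-≥-unique : ∀ lo n (xs : List ℕ) → Unique xs → All (_< n) xs → count (lo ≤?_) xs ≤ n ∸ lo
count-≥-unique lo n xs u xs<n = length-unique-inRange lo n (filter (lo ≤?_) xs) (filter⁺ (lo ≤?_) u)
  (All.zip (All.all-filter (lo ≤?_) xs , All.filter⁺ (lo ≤?_) xs<n))

All-<-by-counting : ∀ lo n p rest → Unique (p ++ rest) → All (_< n) (p ++ rest) →
  n ∸ lo ≤ count (lo ≤?_) rest → All (_< lo) p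
All-<-by-counting lo n p rest u σ<n rest-fills = All.map ≰⇒> (count≤0⇒All¬ (lo ≤?_) p
  (+-cancelʳ-≤ (count (lo ≤?_) rest) _ 0 (begin
    count (lo ≤?_) p + count (lo ≤?_) rest ≡⟨ count-++ (lo ≤?_) p rest ⟨
    count (lo ≤?_) (p ++ rest)              ≤⟨ count-≥-unique lo n (p ++ rest) u σ<n ⟩
    n ∸ lo                                  ≤⟨ rest-fills ⟩
    count (lo ≤?_) rest                     ∎)))
  where open ≤-Reasoning

All-≥-by-counting : ∀ hi pre s → Unique (pre ++ s) → hi ≤ count (_<? hi) pre → All (hi ≤_) s
All-≥-by-counting hi pre s u pre-fills = All.map ≮⇒≥ (count≤0⇒All¬ (_<? hi) s
  (+-cancelˡ-≤ (count (_<? hi) pre) _ 0 (begin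
    count (_<? hi) pre + count (_<? hi) s ≡⟨ count-++ (_<? hi) pre s ⟨
    count (_<? hi) (pre ++ s)             ≤⟨ count-<-unique hi (pre ++ s) u ⟩
    hi                                    ≤⟨ pre-fills ⟩
    count (_<? hi) pre                    ≡⟨ +-identityʳ _ ⟨
    count (_<? hi) pre + 0                ∎)))
  where open ≤-Reasoning

x<h-from-≤∸ : ∀ {h a x} → x < h + a → a ≤ h + a ∸ suc x → x < h
x<h-from-≤∸ {h} {a} {x} x<h+a a≤ = +-cancelʳ-≤ a (suc x) h (begin
  suc x + a               ≡⟨ +-comm (suc x) a ⟩
  a + suc x               ≤⟨ +-monoˡ-≤ (suc x) a≤ ⟩
  h + a ∸ suc x + suc x   ≡⟨ m∸n+n≡m x<h+a ⟩
  h + a                   ∎)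
  where open ≤-Reasoning

count-upTo-suc : ∀ {P : ℕ → Set} (P? : Decidable P) n → count P? (upTo (suc n)) ≡ count P? (upTo n) + count P? [ n ]
count-upTo-suc P? n = trans (cong (count P?) (sym (applyUpTo-∷ʳ id n))) (count-++ P? (upTo n) [ n ])

count-inRange-upTo-≤ : ∀ lo hi n → n ≤ hi → count (InRange? lo hi) (upTo n) ≡ n ∸ lo
count-inRange-upTo-≤ lo hi zero _ = sym (0∸n≡0 lo)
count-inRange-upTo-≤ lo hi (suc n) 1+n≤hi with lo ≤? n
... | yes lo≤n = begin
  count (InRange? lo hi) (upTo (suc n)) ≡⟨ count-upTo-suc (InRange? lo hi) n ⟩
  count (InRange? lo hi) (upTo n) + count (InRange? lo hi) [ n ]
    ≡⟨ cong₂ _+_ ih (cong length (filter-accept (InRange? lo hi) (lo≤n , 1+n≤hi))) ⟩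
  n ∸ lo + 1                          ≡⟨ +-comm (n ∸ lo) 1 ⟩
  suc (n ∸ lo)                        ≡⟨ +-∸-assoc 1 lo≤n ⟨
  suc n ∸ lo                          ∎
  where
  open ≡-Reasoning
  ih = count-inRange-upTo-≤ lo hi n (≤-trans (n≤1+n n) 1+n≤hi)
... | no lo≰n = begin
  count (InRange? lo hi) (upTo (suc n)) ≡⟨ count-upTo-suc (InRange? lo hi) n ⟩
  count (InRange? lo hi) (upTo n) + count (InRange? lo hi) [ n ]
    ≡⟨ cong₂ _+_ ih (cong length (filter-reject (InRange? lo hi) (lo≰n ∘ proj₁))) ⟩
  n ∸ lo + 0                          ≡⟨ +-identityʳ (n ∸ lo) ⟩
  n ∸ lo                              ≡⟨ m≤n⇒m∸n≡0 (<⇒≤ n<lo) ⟩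
  0                                   ≡⟨ m≤n⇒m∸n≡0 n<lo ⟨
  suc n ∸ lo                          ∎
  where
  open ≡-Reasoning
  n<lo = ≰⇒> lo≰n
  ih = count-inRange-upTo-≤ lo hi n (≤-trans (n≤1+n n) 1+n≤hi)

count-inRange-upTo : ∀ lo hi n → hi ≤ n → count (InRange? lo hi) (upTo n) ≡ hi ∸ lo
count-inRange-upTo lo hi zero z≤n = count-inRange-upTo-≤ lo 0 0 z≤n
count-inRange-upTo lo hi (suc n) hi≤1+n with m≤n⇒m<n∨m≡n hi≤1+n
... | inj₂ refl = count-inRange-upTo-≤ lo hi (suc n) ≤-refl
... | inj₁ hi<1+n = begin
  count (InRange? lo hi) (upTo (suc n)) ≡⟨ count-upTo-suc (InRange? lo hi) n ⟩
  count (InRange? lo hi) (upTo n) + count (InRange? lo hi) [ n ]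
    ≡⟨ cong₂ _+_ (count-inRange-upTo lo hi n hi≤n) (cong length (filter-reject (InRange? lo hi) (≤⇒≯ hi≤n ∘ proj₂))) ⟩
  hi ∸ lo + 0                          ≡⟨ +-identityʳ (hi ∸ lo) ⟩
  hi ∸ lo                              ∎
  where
  open ≡-Reasoning
  hi≤n = ≤-pred hi<1+n

module _ (n : ℕ) where

  Free : ℕ → ℕ → List ℕ → ℕ → Set
  Free lo hi S y = InRange lo hi y × y ∉ S

  Free? : ∀ lo hi S → Decidable (Free lo hi S)
  Free? lo hi S y = InRange? lo hi y ×-dec ¬? (y ∈? S)

  #free : ℕ → ℕ → List ℕ → ℕ
  #free lo hi S = count (Free? lo hi S) (upTo n)

  #free-∷ʳ : ∀ {lo hi S x} → x < n → Free lo hi S x → #free lo hi S ≡ suc (#free lo hi (S ++ [ x ]))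
  #free-∷ʳ {lo} {hi} {S} {x} x<n free-x =
    trans (count-remove (Free? lo hi S) _≟_ (upTo n) (upTo⁺ n) (∈-upTo⁺ x<n) free-x)
          (cong suc (count-cong-All _ (Free? lo hi (S ++ [ x ])) (upTo n) (All.tabulate λ _ → to , from)))
    where
    to : ∀ {y} → Free lo hi S y × y ≢ x → Free lo hi (S ++ [ x ]) y
    to ((y∈ , y∉S) , y≢x) = y∈ , λ y∈S∷x → [ y∉S , (λ where (here y≡x) → y≢x y≡x) ]′ (∈-++⁻ S y∈S∷x)
    from : ∀ {y} → Free lo hi (S ++ [ x ]) y → Free lo hi S y × y ≢ x
    from (y∈ , y∉S∷x) = (y∈ , y∉S∷x ∘ ∈-++⁺ˡ) , λ y≡x → y∉S∷x (∈-++⁺ʳ S (here y≡x))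

  #free-disjoint : ∀ lo hi S → hi ≤ n → (∀ {y} → InRange lo hi y → y ∉ S) → #free lo hi S ≡ hi ∸ lo
  #free-disjoint lo hi S hi≤n range#S =
    trans (count-cong-All (Free? lo hi S) (InRange? lo hi) (upTo n) (All.tabulate λ _ → proj₁ , λ y∈ → y∈ , range#S y∈))
          (count-inRange-upTo lo hi n hi≤n)

count-words-suc : ∀ {P : List ℕ → Set} (P? : Decidable P) n k →
  count P? (words n (suc k)) ≡ sum (map (λ x → count (λ w → P? (x ∷ w)) (words n k)) (upTo n))
count-words-suc P? n k = go (upTo n)
  where
  go : ∀ xs → count P? (concatMap (λ x → map (x ∷_) (words n k)) xs)
            ≡ sum (map (λ x → count (λ w → P? (x ∷ w)) (words n k)) xs)
  go [] = refl
  go (x ∷ xs) = trans (count-++ P? (map (x ∷_) (words n k)) _)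
                      (cong₂ _+_ (count-map P? (x ∷_) (words n k)) (go xs))

words-length-bounded : ∀ n k → All (λ w → length w ≡ k × All (_< n) w) (words n k)
words-length-bounded n zero = (refl , []) ∷ []
words-length-bounded n (suc k) = go (upTo n) (All.tabulate ∈-upTo⁻)
  where
  go : ∀ xs → All (_< n) xs → All (λ w → length w ≡ suc k × All (_< n) w) (concatMap (λ x → map (x ∷_) (words n k)) xs)
  go [] [] = []
  go (x ∷ xs) (x<n ∷ xs<n) =
    All.++⁺ (All.map⁺ (All.map (λ (lw , w<n) → cong suc lw , x<n ∷ w<n) (words-length-bounded n k))) (go xs xs<n)

record Block : Set where
  constructor block
  field lo hi len : ℕ

Fits : List Block → List ℕ → Set
Fits [] [] = ⊤
Fits [] (_ ∷ _) = ⊥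
Fits (block lo hi zero ∷ bs) w = Fits bs w
Fits (block lo hi (suc k) ∷ bs) [] = ⊥
Fits (block lo hi (suc k) ∷ bs) (x ∷ w) = InRange lo hi x × Fits (block lo hi k ∷ bs) w

Fits? : ∀ bs → Decidable (Fits bs)
Fits? [] [] = yes tt
Fits? [] (_ ∷ _) = no λ ()
Fits? (block lo hi zero ∷ bs) w = Fits? bs w
Fits? (block lo hi (suc k) ∷ bs) [] = no λ ()
Fits? (block lo hi (suc k) ∷ bs) (x ∷ w) = InRange? lo hi x ×-dec Fits? (block lo hi k ∷ bs) w

totalLength : List Block → ℕ
totalLength bs = sum (map Block.len bs)

FitExtension : List ℕ → List Block → List ℕ → Set
FitExtension S bs w = Unique (S ++ w) × Fits bs w

FitExtension? : ∀ S bs → Decidable (FitExtension S bs)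
FitExtension? S bs w = unique? (S ++ w) ×-dec Fits? bs w

#fitExtensions : ℕ → List ℕ → List Block → ℕ
#fitExtensions n S bs = count (FitExtension? S bs) (words n (totalLength bs))

#fitExtensions-[] : ∀ n S → Unique S → #fitExtensions n S [] ≡ 1
#fitExtensions-[] n S u = cong length (filter-accept (FitExtension? S []) (subst Unique (sym (++-identityʳ S)) u , tt))

#extensionsStartingWith : ℕ → List ℕ → Block → List Block → ℕ → ℕ
#extensionsStartingWith n S (block lo hi k) bs x =
  count (λ w → FitExtension? S (block lo hi (suc k) ∷ bs) (x ∷ w)) (words n (totalLength (block lo hi k ∷ bs)))

#extensionsStartingWith-free : ∀ n S lo hi k bs {x} → InRange lo hi x →
  #extensionsStartingWith n S (block lo hi k) bs x ≡ #fitExtensions n (S ++ [ x ]) (block lo hi k ∷ bs)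
#extensionsStartingWith-free n S lo hi k bs {x} x∈ =
  count-cong-All _ (FitExtension? (S ++ [ x ]) (block lo hi k ∷ bs)) (words n (totalLength (block lo hi k ∷ bs)))
    (All.tabulate λ {w} _ → (λ (u , _ , fits) → subst Unique (sym (++-assoc S [ x ] w)) u , fits)
                          , (λ (u , fits) → subst Unique (++-assoc S [ x ] w) u , x∈ , fits))

#extensionsStartingWith-used : ∀ n S lo hi k bs {x} → ¬ Free n lo hi S x →
  #extensionsStartingWith n S (block lo hi k) bs x ≡ 0
#extensionsStartingWith-used n S lo hi k bs {x} x-used =
  cong length (filter-none (λ w → FitExtension? S (block lo hi (suc k) ∷ bs) (x ∷ w)) {words n (totalLength (block lo hi k ∷ bs))}
    (All.tabulate λ _ (u , x∈ , _) → x-used (x∈ , λ x∈S → proj₂ (proj₂ (Unique-++⁻ S u)) (x∈S , here refl))))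

-- Each free value may start the first segment, and every start leaves one value fewer free.
#fitExtensions-∷ : ∀ n lo hi k bs C S → hi ≤ n → Unique S → #free n lo hi S ≡ k →
  (∀ u → length u ≡ k → All (InRange lo hi) u → Unique (S ++ u) → #fitExtensions n (S ++ u) bs ≡ C) →
  #fitExtensions n S (block lo hi k ∷ bs) ≡ k ! * C
#fitExtensions-∷ n lo hi zero bs C S _ uS _ extend = begin
  #fitExtensions n S bs         ≡⟨ cong (λ T → #fitExtensions n T bs) (++-identityʳ S) ⟨
  #fitExtensions n (S ++ []) bs ≡⟨ extend [] refl [] (subst Unique (sym (++-identityʳ S)) uS) ⟩
  C                             ≡⟨ +-identityʳ C ⟨
  0 ! * C                       ∎
  where open ≡-Reasoning
#fitExtensions-∷ n lo hi (suc k) bs C S hi≤n uS free≡ extend = begin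
  #fitExtensions n S (block lo hi (suc k) ∷ bs)
    ≡⟨ count-words-suc (FitExtension? S (block lo hi (suc k) ∷ bs)) n (totalLength (block lo hi k ∷ bs)) ⟩
  sum (map (#extensionsStartingWith n S (block lo hi k) bs) (upTo n))
    ≡⟨ sum-map-supported (Free? n lo hi S) _ (k ! * C) (upTo n) startFree (λ _ → #extensionsStartingWith-used n S lo hi k bs) ⟩
  #free n lo hi S * (k ! * C)
    ≡⟨ cong (_* (k ! * C)) free≡ ⟩
  suc k * (k ! * C)
    ≡⟨ *-assoc (suc k) (k !) C ⟨
  suc k ! * C
    ∎
  where
  open ≡-Reasoning
  startFree : ∀ x → Free n lo hi S x → #extensionsStartingWith n S (block lo hi k) bs x ≡ k ! * C
  startFree x (x∈ , x∉S) = trans (#extensionsStartingWith-free n S lo hi k bs x∈)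
    (#fitExtensions-∷ n lo hi k bs C (S ++ [ x ]) hi≤n (Unique-∷ʳ uS x∉S) free′≡ extend′)
    where
    free′≡ : #free n lo hi (S ++ [ x ]) ≡ k
    free′≡ = suc-injective (trans (sym (#free-∷ʳ n (<-≤-trans (proj₂ x∈) hi≤n) (x∈ , x∉S))) free≡)
    extend′ : ∀ u → length u ≡ k → All (InRange lo hi) u → Unique ((S ++ [ x ]) ++ u) →
              #fitExtensions n ((S ++ [ x ]) ++ u) bs ≡ C
    extend′ u len-u u∈ uSxu = subst (λ T → #fitExtensions n T bs ≡ C) (sym (++-assoc S [ x ] u))
      (extend (x ∷ u) (cong suc len-u) (x∈ ∷ u∈) (subst Unique (++-assoc S [ x ] u) uSxu))

tiling : ℕ → List ℕ → List Block
tiling lo [] = []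
tiling lo (k ∷ ks) = block lo (lo + k) k ∷ tiling (lo + k) ks

#fitExtensions-tiling : ∀ n lo ks S → lo + sum ks ≤ n → Unique S → All (_< lo) S →
  #fitExtensions n S (tiling lo ks) ≡ product (map _! ks)
#fitExtensions-tiling n lo [] S _ uS _ = #fitExtensions-[] n S uS
#fitExtensions-tiling n lo (k ∷ ks) S lo+Σ≤n uS S<lo =
  #fitExtensions-∷ n lo (lo + k) k (tiling (lo + k) ks) (product (map _! ks)) S hi≤n uS free≡ extend
  where
  hi≤n : lo + k ≤ n
  hi≤n = ≤-trans (+-monoʳ-≤ lo (m≤m+n k (sum ks))) lo+Σ≤n
  free≡ : #free n lo (lo + k) S ≡ k
  free≡ = trans (#free-disjoint n lo (lo + k) S hi≤n λ (lo≤y , _) y∈S → <⇒≱ (All.lookup S<lo y∈S) lo≤y)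
                (m+n∸m≡n lo k)
  extend : ∀ u → length u ≡ k → All (InRange lo (lo + k)) u → Unique (S ++ u) →
           #fitExtensions n (S ++ u) (tiling (lo + k) ks) ≡ product (map _! ks)
  extend u _ u∈ uSu = #fitExtensions-tiling n (lo + k) ks (S ++ u)
    (subst (_≤ n) (sym (+-assoc lo k (sum ks))) lo+Σ≤n) uSu
    (All.++⁺ (All.map (λ y<lo → <-≤-trans y<lo (m≤m+n lo k)) S<lo) (All.map proj₂ u∈))

Fits-++⁻ : ∀ {lo hi k bs} p {q} → length p ≡ k → Fits (block lo hi k ∷ bs) (p ++ q) → All (InRange lo hi) p × Fits bs q
Fits-++⁻ [] refl fits = [] , fits
Fits-++⁻ (x ∷ p) refl (x∈ , fits) = map₁ (x∈ ∷_) (Fits-++⁻ p refl fits)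

Fits-++⁺ : ∀ {lo hi k bs} p {q} → length p ≡ k → All (InRange lo hi) p → Fits bs q → Fits (block lo hi k ∷ bs) (p ++ q)
Fits-++⁺ [] refl [] fits = fits
Fits-++⁺ (x ∷ p) refl (x∈ ∷ p∈) fits = x∈ , Fits-++⁺ p refl p∈ fits

#less≡count : ∀ x ys → #less x ys ≡ count (_<? x) ys
#less≡count x [] = refl
#less≡count x (y ∷ ys) with y <ᵇ x
... | true  = cong suc (#less≡count x ys)
... | false = #less≡count x ys

#greater≡count : ∀ x ys → #greater x ys ≡ count (x <?_) ys
#greater≡count x [] = refl
#greater≡count x (y ∷ ys) with x <ᵇ y
... | true  = cong suc (#greater≡count x ys)
... | false = #greater≡count x ys

module _ (a c : ℕ) where

  mmpAux-++-prefix : ∀ pre p rest → length pre + length p ≤ c → mmpAux a c pre (p ++ rest) ≡ mmpAux a c (pre ++ p) rest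
  mmpAux-++-prefix pre [] rest _ = cong (λ T → mmpAux a c T rest) (sym (++-identityʳ pre))
  mmpAux-++-prefix pre (x ∷ p) rest pre+p<c = begin
    indicator (a ≤? #greater x (p ++ rest)) (c ≤? #less x pre) + mmpAux a c (pre ++ [ x ]) (p ++ rest)
      ≡⟨ cong₂ _+_ (indicator≡0ʳ (a ≤? _) (c ≤? _) few-smaller) (mmpAux-++-prefix (pre ++ [ x ]) p rest pre′+p≤c) ⟩
    mmpAux a c ((pre ++ [ x ]) ++ p) rest
      ≡⟨ cong (λ T → mmpAux a c T rest) (++-assoc pre [ x ] p) ⟩
    mmpAux a c (pre ++ x ∷ p) rest
      ∎
    where
    open ≡-Reasoning
    pre<c : length pre < c
    pre<c = <-≤-trans (m<m+n (length pre) z<s) pre+p<c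
    few-smaller : ¬ c ≤ #less x pre
    few-smaller = <⇒≱ (≤-<-trans (subst (_≤ length pre) (sym (#less≡count x pre)) (length-filter (_<? x) pre)) pre<c)
    pre′+p≤c : length (pre ++ [ x ]) + length p ≤ c
    pre′+p≤c = subst (_≤ c) (sym (trans (cong (_+ length p) (length-++ pre)) (+-assoc (length pre) 1 (length p)))) pre+p<c

  mmpAux-short : ∀ pre s → length s ≤ a → mmpAux a c pre s ≡ 0
  mmpAux-short pre [] _ = refl
  mmpAux-short pre (x ∷ s) s<a = cong₂ _+_
    (indicator≡0ˡ (a ≤? _) (c ≤? _) (<⇒≱ (≤-<-trans greater≤s s<a)))
    (mmpAux-short (pre ++ [ x ]) s (≤-trans (n≤1+n _) s<a))
    where
    greater≤s : #greater x s ≤ length s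
    greater≤s = subst (_≤ length s) (sym (#greater≡count x s)) (length-filter (x <?_) s)

  mmpAux-++-short-≤ : ∀ pre m s → length s ≤ a → mmpAux a c pre (m ++ s) ≤ length m
  mmpAux-++-short-≤ pre [] s s≤a = ≤-reflexive (mmpAux-short pre s s≤a)
  mmpAux-++-short-≤ pre (x ∷ m) s s≤a =
    +-mono-≤ (indicator≤1 (a ≤? _) (c ≤? _)) (mmpAux-++-short-≤ (pre ++ [ x ]) m s s≤a)

  AllMatch : List ℕ → List ℕ → List ℕ → Set
  AllMatch pre [] s = ⊤
  AllMatch pre (x ∷ m) s = (a ≤ count (x <?_) (m ++ s) × c ≤ count (_<? x) pre) × AllMatch (pre ++ [ x ]) m s

  mmpAux-++-short≡length⇒AllMatch : ∀ pre m s → length s ≤ a → mmpAux a c pre (m ++ s) ≡ length m → AllMatch pre m s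
  mmpAux-++-short≡length⇒AllMatch pre [] s _ _ = tt
  mmpAux-++-short≡length⇒AllMatch pre (x ∷ m) s s≤a eq =
    (subst (a ≤_) (#greater≡count x (m ++ s)) a≤G , subst (c ≤_) (#less≡count x pre) c≤L) ,
    mmpAux-++-short≡length⇒AllMatch (pre ++ [ x ]) m s s≤a rest≡
    where
    a?  = a ≤? #greater x (m ++ s)
    c?  = c ≤? #less x pre
    rest = mmpAux a c (pre ++ [ x ]) (m ++ s)
    rest≤ = mmpAux-++-short-≤ (pre ++ [ x ]) m s s≤a
    rest≡ : rest ≡ length m
    rest≡ = ≤-antisym rest≤ (≤-pred (subst (_≤ suc rest) eq (+-monoˡ-≤ rest (indicator≤1 a? c?))))
    a≤G×c≤L = indicator≡1⁻ a? c? (+-cancelʳ-≡ _ _ 1 (trans eq (cong suc (sym rest≡))))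
    a≤G = proj₁ a≤G×c≤L
    c≤L = proj₂ a≤G×c≤L

  AllMatch⇒mmpAux-++-short≡length : ∀ pre m s → length s ≤ a → AllMatch pre m s → mmpAux a c pre (m ++ s) ≡ length m
  AllMatch⇒mmpAux-++-short≡length pre [] s s≤a _ = mmpAux-short pre s s≤a
  AllMatch⇒mmpAux-++-short≡length pre (x ∷ m) s s≤a ((a≤G , c≤L) , match) = cong₂ _+_
    (indicator≡1 (a ≤? _) (c ≤? _) (subst (a ≤_) (sym (#greater≡count x (m ++ s))) a≤G)
                                   (subst (c ≤_) (sym (#less≡count x pre)) c≤L))
    (AllMatch⇒mmpAux-++-short≡length (pre ++ [ x ]) m s s≤a match)

module Extremal (a c k : ℕ) where

  H n : ℕ
  H = c + suc k
  n = H + a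

  Shape : List ℕ → List ℕ → List ℕ → Set
  Shape p m s = All (InRange 0 c) p × All (InRange c H) m × All (InRange H n) s

  blocks : List Block
  blocks = tiling 0 (c ∷ suc k ∷ a ∷ [])

  Fits⇒Shape : ∀ p m s → length p ≡ c → length m ≡ suc k → length s ≡ a → Fits blocks (p ++ m ++ s) → Shape p m s
  Fits⇒Shape p m s len-p len-m len-s fits =
    let p∈ , fits′  = Fits-++⁻ p len-p fits
        m∈ , fits″  = Fits-++⁻ m len-m fits′
        s∈ , _      = Fits-++⁻ s {[]} len-s (subst (Fits (block H n a ∷ [])) (sym (++-identityʳ s)) fits″)
    in p∈ , m∈ , s∈

  Shape⇒Fits : ∀ p m s → length p ≡ c → length m ≡ suc k → length s ≡ a → Shape p m s → Fits blocks (p ++ m ++ s)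
  Shape⇒Fits p m s len-p len-m len-s (p∈ , m∈ , s∈) =
    Fits-++⁺ p len-p p∈ (Fits-++⁺ m len-m m∈ (subst (Fits (block H n a ∷ [])) (++-identityʳ s) (Fits-++⁺ s len-s s∈ tt)))

  AllMatch-intro : ∀ pre m s → (∀ {y} → c ≤ y → c ≤ count (_<? y) pre) → All (InRange c H) m →
    (∀ {y} → y < H → a ≤ count (y <?_) s) → AllMatch a c pre m s
  AllMatch-intro pre [] s _ [] _ = tt
  AllMatch-intro pre (x ∷ m) s enough-below ((c≤x , x<H) ∷ m∈) enough-above =
    (≤-trans (enough-above x<H) (≤-trans (m≤n+m _ _) (≤-reflexive (sym (count-++ (x <?_) m s)))) , enough-below c≤x) ,
    AllMatch-intro (pre ++ [ x ]) m s
      (λ {y} c≤y → ≤-trans (enough-below c≤y) (≤-trans (m≤m+n _ _) (≤-reflexive (sym (count-++ (_<? y) pre [ x ])))))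
      m∈ enough-above

  Shape⇒AllMatch : ∀ p m s → length p ≡ c → length s ≡ a → Shape p m s → AllMatch a c p m s
  Shape⇒AllMatch p m s len-p len-s (p∈ , m∈ , s∈) = AllMatch-intro p m s
    (λ {y} c≤y → ≤-reflexive (sym (trans (count-all (_<? y) (All.map (λ (_ , x<c) → <-≤-trans x<c c≤y) p∈)) len-p)))
    m∈
    (λ {y} y<H → ≤-reflexive (sym (trans (count-all (y <?_) (All.map (λ (H≤x , _) → <-≤-trans y<H H≤x) s∈)) len-s)))

  -- A matching middle entry x has c smaller entries before it and a larger ones after it,
  -- so by pigeonhole c ≤ x and a ≤ n ∸ suc x.
  AllMatch⇒middle : ∀ pre m s → Unique (pre ++ m ++ s) → All (_< n) (m ++ s) → AllMatch a c pre m s → All (InRange c H) m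
  AllMatch⇒middle pre [] s _ _ _ = []
  AllMatch⇒middle pre (x ∷ m) s u (x<n ∷ rest<n) ((a≤above , c≤below) , match) =
    (≤-trans c≤below (count-<-unique x pre u-pre) ,
     x<h-from-≤∸ x<n (≤-trans a≤above (count-≥-unique (suc x) n (m ++ s) u-rest rest<n))) ∷
    AllMatch⇒middle (pre ++ [ x ]) m s (subst Unique (sym (++-assoc pre [ x ] (m ++ s))) u) rest<n match
    where
    u-pre : Unique pre
    u-pre = proj₁ (Unique-++⁻ pre u)
    u-rest : Unique (m ++ s)
    u-rest with proj₁ (proj₂ (Unique-++⁻ pre u))
    ... | _ ∷ u-rest = u-rest

  AllMatch-last : ∀ pre m q s → AllMatch a c pre (m ++ [ q ]) s → a ≤ count (q <?_) s
  AllMatch-last pre [] q s ((a≤above , _) , _) = a≤above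
  AllMatch-last pre (x ∷ m) q s (_ , match) = AllMatch-last (pre ++ [ x ]) m q s match

  -- The middle block lies in [c, H) and the suffix lies above the last middle entry; so the
  -- values ≥ c are used up by m ++ s and the values < H by p ++ m.
  AllMatch⇒Shape : ∀ p m s → length p ≡ c → length m ≡ suc k → length s ≡ a →
    Unique (p ++ m ++ s) → All (_< n) (p ++ m ++ s) → AllMatch a c p m s → Shape p m s
  AllMatch⇒Shape p m s len-p len-m len-s u σ<n match = p∈ , m∈ , s∈
    where
    s<n = All.++⁻ʳ m (All.++⁻ʳ p σ<n)
    m∈ : All (InRange c H) m
    m∈ = AllMatch⇒middle p m s u (All.++⁻ʳ p σ<n) match
    s≥c : All (c ≤_) s
    s≥c with initLast m
    ... | [] = contradiction len-m λ ()
    ... | m′ ∷ʳ′ q = All.map (λ q<y → ≤-trans c≤q (<⇒≤ q<y))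
                       (count≥length⇒All (q <?_) s (subst (_≤ count (q <?_) s) (sym len-s) (AllMatch-last p m′ q s match)))
      where c≤q = proj₁ (All.head (All.++⁻ʳ m′ m∈))
    p∈ : All (InRange 0 c) p
    p∈ = All.map (z≤n ,_) (All-<-by-counting c n p (m ++ s) u σ<n (≤-reflexive (begin
      n ∸ c                                  ≡⟨ cong (_∸ c) (+-assoc c (suc k) a) ⟩
      c + (suc k + a) ∸ c                    ≡⟨ m+n∸m≡n c (suc k + a) ⟩
      suc k + a                              ≡⟨ cong₂ _+_ (sym (trans (count-all (c ≤?_) (All.map proj₁ m∈)) len-m))
                                                         (sym (trans (count-all (c ≤?_) s≥c) len-s)) ⟩
      count (c ≤?_) m + count (c ≤?_) s      ≡⟨ count-++ (c ≤?_) m s ⟨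
      count (c ≤?_) (m ++ s)                 ∎)))
      where open ≡-Reasoning
    s∈ : All (InRange H n) s
    s∈ = All.zip (All-≥-by-counting H (p ++ m) s (subst Unique (sym (++-assoc p m s)) u) (≤-reflexive (begin
      c + suc k                              ≡⟨ cong₂ _+_ (sym (trans (count-all (_<? H) p<H) len-p))
                                                         (sym (trans (count-all (_<? H) (All.map proj₂ m∈)) len-m)) ⟩
      count (_<? H) p + count (_<? H) m      ≡⟨ count-++ (_<? H) p m ⟨
      count (_<? H) (p ++ m)                 ∎)) , s<n)
      where
      open ≡-Reasoning
      p<H = All.map (λ (_ , x<c) → <-≤-trans x<c (m≤m+n c (suc k))) p∈

  mmp-++ : ∀ p rest → length p ≡ c → mmp a c (p ++ rest) ≡ mmpAux a c p rest
  mmp-++ p rest len-p = mmpAux-++-prefix a c [] p rest (≤-reflexive len-p)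

  split : ∀ σ → length σ ≡ n → Σ[ p ∈ List ℕ ] Σ[ m ∈ List ℕ ] Σ[ s ∈ List ℕ ]
    σ ≡ p ++ m ++ s × length p ≡ c × length m ≡ suc k × length s ≡ a
  split σ len-σ with splitAt-length c (suc k + a) σ (trans len-σ (+-assoc c (suc k) a))
  ... | p , rest , refl , len-p , len-rest with splitAt-length (suc k) a rest len-rest
  ...   | m , s , refl , len-m , len-s = p , m , s , refl , len-p , len-m , len-s

  mmp≤ : ∀ σ → length σ ≡ n → mmp a c σ ≤ suc k
  mmp≤ σ len-σ with split σ len-σ
  ... | p , m , s , refl , len-p , len-m , len-s = begin
    mmp a c (p ++ m ++ s)     ≡⟨ mmp-++ p (m ++ s) len-p ⟩
    mmpAux a c p (m ++ s)     ≤⟨ mmpAux-++-short-≤ a c p m s (≤-reflexive len-s) ⟩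
    length m                  ≡⟨ len-m ⟩
    suc k                     ∎
    where open ≤-Reasoning

  maximal⇔FitExtension : ∀ σ → length σ ≡ n → All (_< n) σ →
    (Unique σ × mmp a c σ ≡ suc k → FitExtension [] blocks σ) × (FitExtension [] blocks σ → Unique σ × mmp a c σ ≡ suc k)
  maximal⇔FitExtension σ len-σ σ<n with split σ len-σ
  ... | p , m , s , refl , len-p , len-m , len-s = to , from
    where
    to : Unique (p ++ m ++ s) × mmp a c (p ++ m ++ s) ≡ suc k → FitExtension [] blocks (p ++ m ++ s)
    to (u , mmp≡) = u , Shape⇒Fits p m s len-p len-m len-s (AllMatch⇒Shape p m s len-p len-m len-s u σ<n
      (mmpAux-++-short≡length⇒AllMatch a c p m s (≤-reflexive len-s)
        (trans (sym (mmp-++ p (m ++ s) len-p)) (trans mmp≡ (sym len-m)))))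
    from : FitExtension [] blocks (p ++ m ++ s) → Unique (p ++ m ++ s) × mmp a c (p ++ m ++ s) ≡ suc k
    from (u , fits) = u , trans (mmp-++ p (m ++ s) len-p) (trans (AllMatch⇒mmpAux-++-short≡length a c p m s (≤-reflexive len-s)
      (Shape⇒AllMatch p m s len-p len-s (Fits⇒Shape p m s len-p len-m len-s fits))) len-m)

  coeffR-as-count : ∀ j → coeffR a c n j ≡ count (λ σ → unique? σ ×-dec (mmp a c σ ≟ j)) (words n n)
  coeffR-as-count j = count-filter (λ σ → mmp a c σ ≟ j) unique? (words n n)

  coeffR-top : coeffR a c n (suc k) ≡ c ! * (suc k ! * (a ! * 1))
  coeffR-top = begin
    coeffR a c n (suc k)
      ≡⟨ coeffR-as-count (suc k) ⟩
    count (λ σ → unique? σ ×-dec (mmp a c σ ≟ suc k)) (words n n)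
      ≡⟨ count-cong-All _ (FitExtension? [] blocks) (words n n)
           (All.map (λ (len-σ , σ<n) → maximal⇔FitExtension _ len-σ σ<n) (words-length-bounded n n)) ⟩
    count (FitExtension? [] blocks) (words n n)
      ≡⟨ cong (count (FitExtension? [] blocks) ∘ words n) n≡totalLength ⟩
    #fitExtensions n [] blocks
      ≡⟨ #fitExtensions-tiling n 0 (c ∷ suc k ∷ a ∷ []) [] (≤-reflexive (sym n≡totalLength)) [] [] ⟩
    c ! * (suc k ! * (a ! * 1))
      ∎
    where
    open ≡-Reasoning
    n≡totalLength : n ≡ totalLength blocks
    n≡totalLength = trans (+-assoc c (suc k) a) (cong (λ t → c + (suc k + t)) (sym (+-identityʳ a)))

  coeffR-above-top : ∀ j → suc k < j → coeffR a c n j ≡ 0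
  coeffR-above-top j k<j = trans (coeffR-as-count j) (cong length (filter-none _
    (All.map (λ {σ} (len-σ , _) (_ , mmp≡j) → <⇒≱ k<j (subst (_≤ suc k) mmp≡j (mmp≤ σ len-σ)))
             (words-length-bounded n n))))

top-coefficient : ∀ a c k n → n ≡ c + suc k + a →
  coeffR a c n (suc k) ≡ c ! * (suc k ! * (a ! * 1)) × (∀ j → suc k < j → coeffR a c n j ≡ 0)
top-coefficient a c k n refl = Extremal.coeffR-top a c k , Extremal.coeffR-above-top a c k

top-degree-a1-c1 : (n : ℕ) → 3 ≤ n →
  (coeffR 1 1 n (n ∸ 2) ≡ (n ∸ 2) !) × ((k : ℕ) → n ∸ 2 < k → coeffR 1 1 n k ≡ 0)
top-degree-a1-c1 (suc (suc (suc m))) (s≤s (s≤s (s≤s z≤n))) =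
  map₁ (λ eq → trans eq (trans (*-identityˡ _) (*-identityʳ (suc m !))))
       (top-coefficient 1 1 m _ (cong (suc ∘ suc) (sym (+-comm m 1))))

top-degree-a1-c2 : (n : ℕ) → 4 ≤ n →
  (coeffR 1 2 n (n ∸ 3) ≡ 2 * (n ∸ 3) !) × ((k : ℕ) → n ∸ 3 < k → coeffR 1 2 n k ≡ 0)
top-degree-a1-c2 (suc (suc (suc (suc m)))) (s≤s (s≤s (s≤s (s≤s z≤n)))) =
  map₁ (λ eq → trans eq (cong (2 *_) (*-identityʳ (suc m !))))
       (top-coefficient 1 2 m _ (cong (suc ∘ suc ∘ suc) (sym (+-comm m 1))))

top-degree-a2-c2 : (n : ℕ) → 5 ≤ n →
  (coeffR 2 2 n (n ∸ 4) ≡ 4 * (n ∸ 4) !) × ((k : ℕ) → n ∸ 4 < k → coeffR 2 2 n k ≡ 0)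
top-degree-a2-c2 (suc (suc (suc (suc (suc m))))) (s≤s (s≤s (s≤s (s≤s (s≤s z≤n))))) =
  map₁ (λ eq → trans eq (trans (cong (2 *_) (*-comm (suc m !) 2)) (sym (*-assoc 2 2 (suc m !)))))
       (top-coefficient 2 2 m _ (cong (suc ∘ suc ∘ suc) (sym (+-comm m 2))))

mainTheorem19 :
    ((n : ℕ) → 3 ≤ n →
      (coeffR 1 1 n (n ∸ 2) ≡ (n ∸ 2) !) × ((k : ℕ) → n ∸ 2 < k → coeffR 1 1 n k ≡ 0))
    × ((n : ℕ) → 4 ≤ n →
      (coeffR 1 2 n (n ∸ 3) ≡ 2 * (n ∸ 3) !) × ((k : ℕ) → n ∸ 3 < k → coeffR 1 2 n k ≡ 0))
    × ((n : ℕ) → 5 ≤ n →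
      (coeffR 2 2 n (n ∸ 4) ≡ 4 * (n ∸ 4) !) × ((k : ℕ) → n ∸ 4 < k → coeffR 2 2 n k ≡ 0))
mainTheorem19 = top-degree-a1-c1 , top-degree-a1-c2 , top-degree-a2-c2
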